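{- Let $m \ge 1$ and $n \ge 1$ be integers and let $P(X_1,\ldots,X_n) \in \mathbb{R}[X_1,\ldots,X_n]$ sign represent the parity function over $\{0,1,\ldots,m-1\}^n$. If the degree of $P$ in $X_n$ is at most $m-1$, write $P(X_1,\ldots,X_n) = \sum_{i=0}^{m-1} X_n^i Q_i(X_1,\ldots,X_{n-1})$ with $Q_i \in \mathbb{R}[X_1,\ldots,X_{n-1}]$. Then for each $0 \le i \le m-1$, the polynomial $(-1)^i Q_i$ sign represents the parity function over $\{0,1,\ldots,m-1\}^{n-1}$.
   Context: For $A \subseteq \mathbb{Z}$, the parity function on $A^k$ is $\mathrm{Par}(a_1,\ldots,a_k) = \sum_i a_i \bmod 2$ (for $k=0$, $A^0$ is a single point at which parity is $0$). A polynomial $P$ sign represents $f: A^k \to \{0,1\}$ if for every $a \in A^k$: $f(a) = 0 \Rightarrow P(a) > 0$ and $f(a) = 1 \Rightarrow P(a) < 0$. -}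

module Defs where

open import Level using (Level; _⊔_)
open import Data.Nat as ℕ using (ℕ; zero; suc; _%_)
open import Data.Fin as Fin using (Fin; toℕ; fromℕ; inject₁)
open import Data.Fin.Properties using (_≟_)
open import Data.List using (List; []; _∷_)
open import Data.Nat.ListAction using (sum)
open import Data.Vec.Functional as VF using (Vector)
open import Data.Product using (Σ; _×_)
open import Data.Sum using (_⊎_)
import Data.List
open import Relation.Binary.PropositionalEquality using (_≡_)
open import Relation.Nullary using (¬_)
open import Algebra.Bundles using (CommutativeRing)

-- An ordered field (the reals ℝ being the intended instance).
record OrderedField (c ℓ₁ ℓ₂ : Level) : Set (Level.suc (c ⊔ ℓ₁ ⊔ ℓ₂)) where
  field
    commutativeRing : CommutativeRing c ℓ₁
  open CommutativeRing commutativeRing public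
  field
    _<_        : Carrier → Carrier → Set ℓ₂
    <-irrefl   : ∀ {x y} → x ≈ y → ¬ (x < y)
    <-trans    : ∀ {x y z} → x < y → y < z → x < z
    <-resp-≈   : ∀ {x x′ y y′} → x ≈ x′ → y ≈ y′ → x < y → x′ < y′
    <-trichotomy : ∀ x y → (x < y) ⊎ ((x ≈ y) ⊎ (y < x))
    +-mono-<   : ∀ {x y} z → x < y → (x + z) < (y + z)
    *-pos      : ∀ {x y} → 0# < x → 0# < y → 0# < (x * y)
    0<1        : 0# < 1#
    inverse    : ∀ x → ¬ (x ≈ 0#) → Σ Carrier λ y → (x * y) ≈ 1#

Par : ∀ {m k} → Vector (Fin m) k → ℕ
Par {k = k} a = (sum (Data.List.map (λ j → toℕ (a j)) (Data.List.allFin k))) % 2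

module _ {c ℓ₁ ℓ₂} (F : OrderedField c ℓ₁ ℓ₂) where
  open OrderedField F

  pow : Carrier → ℕ → Carrier
  pow x zero    = 1#
  pow x (suc i) = x * pow x i

  embed : ℕ → Carrier
  embed zero    = 0#
  embed (suc n) = 1# + embed n

  -- Multivariate polynomials in k variables X₁,…,X_k with coefficients in F:
  -- a polynomial in k+1 variables is a finite list of coefficients
  -- (polynomials in X₁,…,X_k) of the powers X_{k+1}^0, X_{k+1}^1, …
  Poly : ℕ → Set c
  Poly zero    = Carrier
  Poly (suc k) = List (Poly k)

  -- evaluation at a point x = (x₁,…,x_k); variable X_{k+1} is the last one
  eval : ∀ {k} → Poly k → Vector Carrier k → Carrier
  evalList : ∀ {k} → List (Poly k) → Vector Carrier (suc k) → Carrier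
  eval {zero}  p  x = p
  eval {suc k} ps x = evalList ps x
  evalList {k} []       x = 0#
  evalList {k} (p ∷ ps) x =
    eval p (λ j → x (inject₁ j)) + x (fromℕ k) * evalList ps x

  scale : ∀ {k} → Carrier → Poly k → Poly k
  scaleList : ∀ {k} → Carrier → List (Poly k) → List (Poly k)
  scale {zero}  a p  = a * p
  scale {suc k} a ps = scaleList {k} a ps
  scaleList {k} a []       = []
  scaleList {k} a (p ∷ ps) = scale {k} a p ∷ scaleList {k} a ps

  fromCoeffs : ∀ {k m} → (Fin m → Poly k) → Poly (suc k)
  fromCoeffs {k} {zero}  Q = []
  fromCoeffs {k} {suc m} Q = Q Fin.zero ∷ fromCoeffs {k} {m} (λ i → Q (Fin.suc i))

  SignRepresents : ∀ {k} (m : ℕ) → Poly k → (Vector (Fin m) k → ℕ) → Set ℓ₂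
  SignRepresents {k} m P f = ∀ (a : Vector (Fin m) k) →
      (f a ≡ 0 → 0# < eval P (λ j → embed (toℕ (a j))))
    × (f a ≡ 1 → eval P (λ j → embed (toℕ (a j))) < 0#)

{-# OPTIONS --safe #-}
-- Fix a ∈ {0,…,m-1}^{n-1} with coordinate sum S and let p(x) = Σ_i Q_i(a) x^i.  Since P
-- sign represents parity, p(j) has the sign of (-1)^(S+j) for j = 0,…,m-1, and hence so
-- has the forward difference (Δ^j p)(0).  Writing p(x) = p(t) + (x - t) q(x), the
-- discrete product rule gives (Δ^(d+1) p)(t) = (d+1) (Δ^d q)(t+1), so the quotient q
-- satisfies the same hypothesis one degree lower, based at t+1 and with the opposite
-- sign.  By induction on the degree the coefficients of q alternate in sign, and since
-- t ≥ 0 the relations c₀ = p(t) - t q₀ and c_{i+1} = q_i - t q_{i+1} carry this over to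
-- the coefficients c_i = Q_i(a) of p: each Q_i(a) has the sign of (-1)^(S+i).
module Submission where

open import Defs
open import Level using (_⊔_)
open import Data.Nat as ℕ using (ℕ; zero; suc; _%_; z≤n; s≤s)
import Data.Nat.Properties as ℕ
open import Data.Nat.ListAction using (sum)
open import Data.Fin as Fin using (Fin; toℕ; fromℕ; fromℕ<; inject₁)
import Data.Fin.Properties as Fin
open import Data.List as List using (List; allFin)
import Data.List.Properties as List
open import Data.Vec as Vec using (Vec; []; _∷_; tabulate)
import Data.Vec.Properties as Vec
open import Data.Vec.Functional as Vector using (Vector; init; last; insertAt)
open import Data.Vec.Functional.Properties using (insertAt-lookup)
open import Data.Product using (_×_; _,_)
open import Data.Sum using (inj₁; inj₂)
open import Data.Empty using (⊥; ⊥-elim)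
open import Function using (id; _∘_)
import Relation.Binary.PropositionalEquality as ≡
open ≡ using (_≡_)

coordinateSum : ∀ {m k} → Vector (Fin m) k → ℕ
coordinateSum {k = k} a = sum (List.map (toℕ ∘ a) (allFin k))

sum-tabulate-init-last : ∀ {k} (h : Fin (suc k) → ℕ) →
  sum (List.tabulate h) ≡ sum (List.tabulate (init h)) ℕ.+ last h
sum-tabulate-init-last {zero}  h = ℕ.+-identityʳ (h Fin.zero)
sum-tabulate-init-last {suc k} h =
  ≡.trans (≡.cong (h Fin.zero ℕ.+_) (sum-tabulate-init-last (h ∘ Fin.suc)))
          (≡.sym (ℕ.+-assoc (h Fin.zero) _ _))

insertAt-last-inject₁ : ∀ {a} {A : Set a} {n} (xs : Vector A n) (v : A) (i : Fin n) →
  insertAt xs (fromℕ n) v (inject₁ i) ≡ xs i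
insertAt-last-inject₁ xs v Fin.zero    = ≡.refl
insertAt-last-inject₁ xs v (Fin.suc i) = insertAt-last-inject₁ (Vector.tail xs) v i

Par-insertAt-last : ∀ {m k} (a : Vector (Fin m) k) (j : Fin m) →
  Par (insertAt a (fromℕ k) j) ≡ (coordinateSum a ℕ.+ toℕ j) % 2
Par-insertAt-last {k = k} a j = ≡.cong (_% 2) (begin
  sum (List.map (toℕ ∘ b) (allFin (suc k)))
    ≡⟨ ≡.cong sum (List.map-tabulate id (toℕ ∘ b)) ⟩
  sum (List.tabulate (toℕ ∘ b))
    ≡⟨ sum-tabulate-init-last (toℕ ∘ b) ⟩
  sum (List.tabulate (toℕ ∘ init b)) ℕ.+ toℕ (last b)
    ≡⟨ ≡.cong₂ ℕ._+_ (≡.cong sum init-b) (≡.cong toℕ (insertAt-lookup a (fromℕ k) j)) ⟩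
  coordinateSum a ℕ.+ toℕ j
    ∎)
  where
  open ≡.≡-Reasoning
  b = insertAt a (fromℕ k) j
  init-b : List.tabulate (toℕ ∘ init b) ≡ List.map (toℕ ∘ a) (allFin k)
  init-b = ≡.trans (List.tabulate-cong (≡.cong toℕ ∘ insertAt-last-inject₁ a j))
                   (≡.sym (List.map-tabulate id (toℕ ∘ a)))

module _ {c ℓ₁ ℓ₂} (F : OrderedField c ℓ₁ ℓ₂) where
  open OrderedField F
  open import Algebra.Properties.Ring ring
    using (-1*x≈-x; -‿involutive; -‿distribʳ-*; //-rightDividesˡ; x≈z//y)
  open import Algebra.Solver.Ring.NaturalCoefficients.Default commutativeSemiring
    using (solve; _:=_; _:+_; _:*_; con)
  open import Relation.Binary.Reasoning.Setoid setoid

  private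
    variable
      n s b : ℕ
      p v w x y : Carrier

  +-pos : 0# < x → 0# < y → 0# < (x + y)
  +-pos {x} {y} 0<x 0<y = <-trans 0<y (<-resp-≈ (+-identityˡ y) refl (+-mono-< y 0<x))

  +-embed*-pos : ∀ j → 0# < x → 0# < y → 0# < (x + embed F j * y)
  +-embed*-pos {x} {y} zero    0<x 0<y =
    <-resp-≈ refl (sym (trans (+-congˡ (zeroˡ y)) (+-identityʳ x))) 0<x
  +-embed*-pos {x} {y} (suc j) 0<x 0<y =
    <-resp-≈ refl (shift x (embed F j) y) (+-pos (+-embed*-pos j 0<x 0<y) 0<y)
    where
    shift : ∀ x e y → (x + e * y) + y ≈ x + (1# + e) * y
    shift = solve 3 (λ x e y → (x :+ e :* y) :+ y := x :+ (con 1 :+ e) :* y) refl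

  embed-suc-pos : ∀ j → 0# < embed F (suc j)
  embed-suc-pos zero    = <-resp-≈ refl (sym (+-identityʳ 1#)) 0<1
  embed-suc-pos (suc j) = +-pos 0<1 (embed-suc-pos j)

  x<0⇒0<-x : x < 0# → 0# < (- x)
  x<0⇒0<-x {x} x<0 = <-resp-≈ (-‿inverseʳ x) (+-identityˡ (- x)) (+-mono-< (- x) x<0)

  0<-x⇒x<0 : 0# < (- x) → x < 0#
  0<-x⇒x<0 {x} 0<-x = <-resp-≈ (+-identityˡ x) (-‿inverseˡ x) (+-mono-< x 0<-x)

  0<x⇒¬0<-x : 0# < x → 0# < (- x) → ⊥
  0<x⇒¬0<-x {x} 0<x 0<-x = <-irrefl (sym (-‿inverseʳ x)) (+-pos 0<x 0<-x)

  *-pos-cancelˡ : 0# < p → 0# < (p * w) → 0# < w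
  *-pos-cancelˡ {p} {w} 0<p 0<pw with <-trichotomy 0# w
  ... | inj₁ 0<w        = 0<w
  ... | inj₂ (inj₁ 0≈w) = ⊥-elim (<-irrefl (sym (trans (*-congˡ (sym 0≈w)) (zeroʳ p))) 0<pw)
  ... | inj₂ (inj₂ w<0) = ⊥-elim (0<x⇒¬0<-x 0<pw
    (<-resp-≈ refl (sym (-‿distribʳ-* p w)) (*-pos 0<p (x<0⇒0<-x w<0))))

  record HasSign (s : ℕ) (v : Carrier) : Set ℓ₂ where
    constructor hasSign
    field positive : 0# < (pow F (- 1#) s * v)

  HasSign-resp : v ≈ w → HasSign s v → HasSign s w
  HasSign-resp v≈w (hasSign h) = hasSign (<-resp-≈ refl (*-congˡ v≈w) h)

  HasSign-≡ : ∀ {s t} → s ≡ t → HasSign s v → HasSign t v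
  HasSign-≡ ≡.refl h = h

  pow-suc-* : ∀ s v → pow F (- 1#) (suc s) * v ≈ pow F (- 1#) s * - v
  pow-suc-* s v = trans (swap (- 1#) (pow F (- 1#) s) v) (*-congˡ (-1*x≈-x v))
    where
    swap : ∀ m σ v → (m * σ) * v ≈ σ * (m * v)
    swap = solve 3 (λ m σ v → (m :* σ) :* v := σ :* (m :* v)) refl

  pow-2+ : ∀ s → pow F (- 1#) (suc (suc s)) ≈ pow F (- 1#) s
  pow-2+ s = trans (-1*x≈-x _) (trans (-‿cong (-1*x≈-x _)) (-‿involutive _))

  pow-+ : ∀ x s t → pow F x (s ℕ.+ t) ≈ pow F x s * pow F x t
  pow-+ x zero    t = sym (*-identityˡ (pow F x t))
  pow-+ x (suc s) t = trans (*-congˡ (pow-+ x s t)) (sym (*-assoc x (pow F x s) (pow F x t)))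

  HasSign-neg : HasSign s v → HasSign (suc s) (- v)
  HasSign-neg {s} {v} (hasSign h) =
    hasSign (<-resp-≈ refl (sym (trans (pow-suc-* s (- v)) (*-congˡ (-‿involutive v)))) h)

  HasSign-neg⁻¹ : HasSign (suc s) v → HasSign s (- v)
  HasSign-neg⁻¹ {s} {v} (hasSign h) = hasSign (<-resp-≈ refl (pow-suc-* s v) h)

  HasSign-+ : HasSign s x → HasSign s y → HasSign s (x + y)
  HasSign-+ {s} {x} {y} (hasSign hx) (hasSign hy) =
    hasSign (<-resp-≈ refl (sym (distribˡ (pow F (- 1#) s) x y)) (+-pos hx hy))

  HasSign-+-embed* : ∀ j → HasSign s x → HasSign s y → HasSign s (x + embed F j * y)
  HasSign-+-embed* {s} {x} {y} j (hasSign hx) (hasSign hy) =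
    hasSign (<-resp-≈ refl (sym (expand (pow F (- 1#) s) x (embed F j) y))
                           (+-embed*-pos j hx hy))
    where
    expand : ∀ σ x e y → σ * (x + e * y) ≈ σ * x + e * (σ * y)
    expand = solve 4 (λ σ x e y → σ :* (x :+ e :* y) := σ :* x :+ e :* (σ :* y)) refl

  HasSign-cancel-+-embed* : ∀ j →
    HasSign s (x + embed F j * y) → HasSign (suc s) y → HasSign s x
  HasSign-cancel-+-embed* {x = x} {y} j hz hy =
    HasSign-resp (sym x≈) (HasSign-+-embed* j hz (HasSign-neg⁻¹ hy))
    where
    e = embed F j
    x≈ : x ≈ (x + e * y) + e * - y
    x≈ = trans (x≈z//y x (e * y) (x + e * y) refl) (+-congˡ (-‿distribʳ-* e y))

  HasSign-*-cancelˡ : 0# < p → HasSign s (p * v) → HasSign s v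
  HasSign-*-cancelˡ {p} {s} {v} 0<p (hasSign h) =
    hasSign (*-pos-cancelˡ 0<p (<-resp-≈ refl (swap (pow F (- 1#) s) p v) h))
    where
    swap : ∀ σ p v → σ * (p * v) ≈ p * (σ * v)
    swap = solve 3 (λ σ p v → σ :* (p :* v) := p :* (σ :* v)) refl

  HasSign-pow : ∀ s i → HasSign (s ℕ.+ i) v → HasSign s (pow F (- 1#) i * v)
  HasSign-pow {v} s i (hasSign h) = hasSign (<-resp-≈ refl σσv h)
    where
    σ = pow F (- 1#)
    σσv : σ (s ℕ.+ i) * v ≈ σ s * (σ i * v)
    σσv = trans (*-congʳ (pow-+ (- 1#) s i)) (*-assoc (σ s) (σ i) v)

  SignOfParity : ℕ → Carrier → Set ℓ₂
  SignOfParity s v = (s % 2 ≡ 0 → 0# < v) × (s % 2 ≡ 1 → v < 0#)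

  HasSign⇒SignOfParity : ∀ s → HasSign s v → SignOfParity s v
  HasSign⇒SignOfParity {v} zero (hasSign h) =
    (λ _ → <-resp-≈ refl (*-identityˡ v) h) , λ ()
  HasSign⇒SignOfParity {v} (suc zero) (hasSign h) =
    (λ ()) , λ _ → 0<-x⇒x<0 (<-resp-≈ refl (trans (pow-suc-* 0 v) (*-identityˡ (- v))) h)
  HasSign⇒SignOfParity (suc (suc s)) (hasSign h) =
    HasSign⇒SignOfParity s (hasSign (<-resp-≈ refl (*-congʳ (pow-2+ s)) h))

  SignOfParity⇒HasSign : ∀ s → SignOfParity s v → HasSign s v
  SignOfParity⇒HasSign {v} zero (0<v , _) =
    hasSign (<-resp-≈ refl (sym (*-identityˡ v)) (0<v ≡.refl))
  SignOfParity⇒HasSign {v} (suc zero) (_ , v<0) =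
    hasSign (<-resp-≈ refl (sym (trans (pow-suc-* 0 v) (*-identityˡ (- v))))
                           (x<0⇒0<-x (v<0 ≡.refl)))
  SignOfParity⇒HasSign (suc (suc s)) h =
    hasSign (<-resp-≈ refl (*-congʳ (sym (pow-2+ s)))
                           (HasSign.positive (SignOfParity⇒HasSign s h)))

  horner : Vec Carrier n → Carrier → Carrier
  horner []       x = 0#
  horner (a ∷ as) x = a + x * horner as x

  horner-cong : (as : Vec Carrier n) → x ≈ y → horner as x ≈ horner as y
  horner-cong []       x≈y = refl
  horner-cong (a ∷ as) x≈y = +-congˡ (*-cong x≈y (horner-cong as x≈y))

  quotient : Carrier → Vec Carrier (suc n) → Vec Carrier n
  quotient t (_ ∷ [])     = []
  quotient t (_ ∷ a ∷ as) = horner (a ∷ as) t ∷ quotient t (a ∷ as)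

  horner-quotient : (as : Vec Carrier (suc n)) (u t : Carrier) →
    horner as (u + t) ≈ horner as t + u * horner (quotient t as) (u + t)
  horner-quotient (a ∷ []) u t =
    solve 4 (λ a u t z → a :+ (u :+ t) :* z := (a :+ t :* z) :+ u :* z) refl a u t 0#
  horner-quotient (a ∷ b ∷ bs) u t = begin
    a + (u + t) * horner (b ∷ bs) (u + t)
      ≈⟨ +-congˡ (*-congˡ (horner-quotient (b ∷ bs) u t)) ⟩
    a + (u + t) * (r + u * d)              ≈⟨ regroup a u t r d ⟩
    (a + t * r) + u * (r + (u + t) * d)    ∎
    where
    r = horner (b ∷ bs) t
    d = horner (quotient t (b ∷ bs)) (u + t)
    regroup : ∀ a u t r d → a + (u + t) * (r + u * d) ≈ (a + t * r) + u * (r + (u + t) * d)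
    regroup = solve 5 (λ a u t r d →
      a :+ (u :+ t) :* (r :+ u :* d) := (a :+ t :* r) :+ u :* (r :+ (u :+ t) :* d)) refl

  data Alternating : ℕ → Vec Carrier n → Set (c ⊔ ℓ₂) where
    []  : Alternating b []
    _∷_ : ∀ {a} {as : Vec Carrier n} →
          HasSign b a → Alternating (suc b) as → Alternating b (a ∷ as)

  Alternating-lookup : {as : Vec Carrier n} → Alternating b as →
    ∀ i → HasSign (b ℕ.+ toℕ i) (Vec.lookup as i)
  Alternating-lookup {b = b} (h ∷ _)  Fin.zero    = HasSign-≡ (≡.sym (ℕ.+-identityʳ b)) h
  Alternating-lookup {b = b} (_ ∷ hs) (Fin.suc i) =
    HasSign-≡ (≡.sym (ℕ.+-suc b (toℕ i))) (Alternating-lookup hs i)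

  Alternating-quotient : ∀ t (as : Vec Carrier (suc n)) → HasSign b (horner as (embed F t)) →
    Alternating (suc b) (quotient (embed F t) as) → Alternating b as
  Alternating-quotient t (a ∷ [])     h []        =
    HasSign-resp (trans (+-congˡ (zeroʳ (embed F t))) (+-identityʳ a)) h ∷ []
  Alternating-quotient t (a ∷ b ∷ bs) h (hb ∷ hs) =
    HasSign-cancel-+-embed* t h hb ∷ Alternating-quotient t (b ∷ bs) hb hs

  Δ^ : ℕ → (ℕ → Carrier) → ℕ → Carrier
  Δ^ zero    f j = f j
  Δ^ (suc d) f j = Δ^ d f (suc j) - Δ^ d f j

  Δ^-step : ∀ d f j → Δ^ (suc d) f j + Δ^ d f j ≈ Δ^ d f (suc j)
  Δ^-step d f j = //-rightDividesˡ (Δ^ d f j) (Δ^ d f (suc j))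

  Δ^-step-unique : ∀ d f j → x + Δ^ d f j ≈ Δ^ d f (suc j) → x ≈ Δ^ (suc d) f j
  Δ^-step-unique {x} d f j = x≈z//y x (Δ^ d f j) (Δ^ d f (suc j))

  Δ^-shift : ∀ d f j → Δ^ d (f ∘ suc) j ≡ Δ^ d f (suc j)
  Δ^-shift zero    f j = ≡.refl
  Δ^-shift (suc d) f j = ≡.cong₂ _-_ (Δ^-shift d f (suc j)) (Δ^-shift d f j)

  HasSign-Δ^ : ∀ d b (f : ℕ → Carrier) →
    (∀ j → j ℕ.≤ d → HasSign (b ℕ.+ j) (f j)) → HasSign (b ℕ.+ d) (Δ^ d f 0)
  HasSign-Δ^ zero    b f hf = hf 0 z≤n
  HasSign-Δ^ (suc d) b f hf =
    HasSign-≡ (≡.sym (ℕ.+-suc b d)) (HasSign-+ later (HasSign-neg earlier))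
    where
    later : HasSign (suc b ℕ.+ d) (Δ^ d f 1)
    later = ≡.subst (HasSign _) (Δ^-shift d f 0) (HasSign-Δ^ d (suc b) (f ∘ suc)
      (λ j j≤d → HasSign-≡ (ℕ.+-suc b j) (hf (suc j) (s≤s j≤d))))
    earlier : HasSign (b ℕ.+ d) (Δ^ d f 0)
    earlier = HasSign-Δ^ d b f (λ j j≤d → hf j (ℕ.m≤n⇒m≤1+n j≤d))

  Δ^-product-rule : ∀ {a} {f g : ℕ → Carrier} → (∀ i → f i ≈ a + embed F i * g i) →
    ∀ d j → Δ^ (suc d) f j ≈ embed F j * Δ^ (suc d) g j + embed F (suc d) * Δ^ d g (suc j)
  Δ^-product-rule {a} {f} {g} f≈ zero j = sym (Δ^-step-unique 0 f j (begin
    (J * D + (1# + 0#) * G′) + f j        ≈⟨ +-congˡ (f≈ j) ⟩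
    (J * D + (1# + 0#) * G′) + (a + J * G) ≈⟨ regroup J D G′ a G ⟩
    (a + (1# + 0#) * G′) + J * (D + G)     ≈⟨ +-congˡ (*-congˡ (Δ^-step 0 g j)) ⟩
    (a + (1# + 0#) * G′) + J * G′          ≈⟨ collect a J G′ ⟩
    a + (1# + J) * G′                      ≈⟨ f≈ (suc j) ⟨
    f (suc j)                              ∎))
    where
    J  = embed F j
    D  = Δ^ 1 g j
    G  = g j
    G′ = g (suc j)
    regroup : ∀ J D G′ a G →
      (J * D + (1# + 0#) * G′) + (a + J * G) ≈ (a + (1# + 0#) * G′) + J * (D + G)
    regroup = solve 5 (λ J D G′ a G →
      (J :* D :+ (con 1 :+ con 0) :* G′) :+ (a :+ J :* G)
        := (a :+ (con 1 :+ con 0) :* G′) :+ J :* (D :+ G)) refl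
    collect : ∀ a J G′ → (a + (1# + 0#) * G′) + J * G′ ≈ a + (1# + J) * G′
    collect = solve 3 (λ a J G′ →
      (a :+ (con 1 :+ con 0) :* G′) :+ J :* G′ := a :+ (con 1 :+ J) :* G′) refl
  Δ^-product-rule {a} {f} {g} f≈ (suc d) j = sym (Δ^-step-unique (suc d) f j (begin
    (J * A″ + (1# + K) * A′) + Δ^ (suc d) f j   ≈⟨ +-congˡ (Δ^-product-rule f≈ d j) ⟩
    (J * A″ + (1# + K) * A′) + (J * A + K * B)  ≈⟨ regroup J A″ K A′ A B ⟩
    J * (A″ + A) + (A′ + K * (A′ + B))
      ≈⟨ +-cong (*-congˡ (Δ^-step (suc d) g j)) (+-congˡ (*-congˡ (Δ^-step d g (suc j)))) ⟩
    J * A′ + (A′ + K * B′)                      ≈⟨ collect J A′ K B′ ⟩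
    (1# + J) * A′ + K * B′                      ≈⟨ Δ^-product-rule f≈ d (suc j) ⟨
    Δ^ (suc d) f (suc j)                        ∎))
    where
    J  = embed F j
    K  = embed F (suc d)
    A″ = Δ^ (suc (suc d)) g j
    A  = Δ^ (suc d) g j
    A′ = Δ^ (suc d) g (suc j)
    B  = Δ^ d g (suc j)
    B′ = Δ^ d g (suc (suc j))
    regroup : ∀ J A″ K A′ A B →
      (J * A″ + (1# + K) * A′) + (J * A + K * B) ≈ J * (A″ + A) + (A′ + K * (A′ + B))
    regroup = solve 6 (λ J A″ K A′ A B →
      (J :* A″ :+ (con 1 :+ K) :* A′) :+ (J :* A :+ K :* B)
        := J :* (A″ :+ A) :+ (A′ :+ K :* (A′ :+ B))) refl
    collect : ∀ J A′ K B′ → J * A′ + (A′ + K * B′) ≈ (1# + J) * A′ + K * B′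
    collect = solve 4 (λ J A′ K B′ →
      J :* A′ :+ (A′ :+ K :* B′) := (con 1 :+ J) :* A′ :+ K :* B′) refl

  Alternating-from-Δ^ : ∀ (as : Vec Carrier n) t b (f : ℕ → Carrier) →
    (∀ i → f i ≈ horner as (embed F i + embed F t)) →
    (∀ d → d ℕ.< n → HasSign (b ℕ.+ d) (Δ^ d f 0)) →
    Alternating b as
  Alternating-from-Δ^ []           t b f f≈ hΔ = []
  Alternating-from-Δ^ as@(_ ∷ _) t b f f≈ hΔ =
    Alternating-quotient t as value-at-t
      (Alternating-from-Δ^ q (suc t) (suc b) (g ∘ suc) g-shift hΔq)
    where
    τ = embed F t
    q = quotient τ as
    g : ℕ → Carrier
    g i = horner q (embed F i + τ)
    value-at-t : HasSign b (horner as τ)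
    value-at-t = HasSign-resp (trans (f≈ 0) (horner-cong as (+-identityˡ τ)))
                              (HasSign-≡ (ℕ.+-identityʳ b) (hΔ 0 (s≤s z≤n)))
    g-shift : ∀ i → g (suc i) ≈ horner q (embed F i + embed F (suc t))
    g-shift i = horner-cong q
      (solve 2 (λ e τ → (con 1 :+ e) :+ τ := e :+ (con 1 :+ τ)) refl (embed F i) τ)
    Δ^-quotient : ∀ d → Δ^ (suc d) f 0 ≈ embed F (suc d) * Δ^ d g 1
    Δ^-quotient d = trans
      (Δ^-product-rule (λ i → trans (f≈ i) (horner-quotient as (embed F i) τ)) d 0)
      (trans (+-congʳ (zeroˡ _)) (+-identityˡ _))
    hΔq : ∀ d → d ℕ.< _ → HasSign (suc b ℕ.+ d) (Δ^ d (g ∘ suc) 0)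
    hΔq d d<n = ≡.subst (HasSign _) (≡.sym (Δ^-shift d g 0))
      (HasSign-*-cancelˡ (embed-suc-pos d)
        (HasSign-resp (Δ^-quotient d) (HasSign-≡ (ℕ.+-suc b d) (hΔ (suc d) (s≤s d<n)))))

  Alternating-from-values : ∀ m (as : Vec Carrier (suc m)) b →
    (∀ j → j ℕ.≤ m → HasSign (b ℕ.+ j) (horner as (embed F j))) → Alternating b as
  Alternating-from-values m as b hv =
    Alternating-from-Δ^ as 0 b f (λ i → horner-cong as (sym (+-identityʳ _)))
      (λ d d≤m → HasSign-Δ^ d b f λ j j≤d → hv j (ℕ.≤-trans j≤d (ℕ.s≤s⁻¹ d≤m)))
    where
    f : ℕ → Carrier
    f j = horner as (embed F j)

  eval-cong : ∀ {k} (P : Poly F k) {x y : Vector Carrier k} →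
    (∀ l → x l ≡ y l) → eval F {k} P x ≡ eval F {k} P y
  evalList-cong : ∀ {k} (Ps : List (Poly F k)) {x y : Vector Carrier (suc k)} →
    (∀ l → x l ≡ y l) → evalList F {k} Ps x ≡ evalList F {k} Ps y
  eval-cong {zero}  P  x≡y = ≡.refl
  eval-cong {suc k} Ps x≡y = evalList-cong Ps x≡y
  evalList-cong {k} List.[]       x≡y = ≡.refl
  evalList-cong {k} (P List.∷ Ps) x≡y =
    ≡.cong₂ _+_ (eval-cong P (x≡y ∘ inject₁))
                (≡.cong₂ _*_ (x≡y (fromℕ k)) (evalList-cong Ps x≡y))

  eval-scale : ∀ {k} a (P : Poly F k) x →
    eval F {k} (scale F {k} a P) x ≈ a * eval F {k} P x
  evalList-scaleList : ∀ {k} a (Ps : List (Poly F k)) x →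
    evalList F {k} (scaleList F {k} a Ps) x ≈ a * evalList F {k} Ps x
  eval-scale {zero}  a P  x = refl
  eval-scale {suc k} a Ps x = evalList-scaleList a Ps x
  evalList-scaleList {k} a List.[]       x = sym (zeroʳ a)
  evalList-scaleList {k} a (P List.∷ Ps) x = begin
    eval F {k} (scale F {k} a P) (init x) + last x * evalList F {k} (scaleList F {k} a Ps) x
      ≈⟨ +-cong (eval-scale a P (init x)) (*-congˡ (evalList-scaleList a Ps x)) ⟩
    a * eval F {k} P (init x) + last x * (a * evalList F {k} Ps x)
      ≈⟨ factor a (eval F {k} P (init x)) (last x) (evalList F {k} Ps x) ⟩
    a * (eval F {k} P (init x) + last x * evalList F {k} Ps x) ∎
    where
    factor : ∀ a u z w → a * u + z * (a * w) ≈ a * (u + z * w)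
    factor = solve 4 (λ a u z w → a :* u :+ z :* (a :* w) := a :* (u :+ z :* w)) refl

  evalList-fromCoeffs : ∀ {k m} (Q : Fin m → Poly F k) (x : Vector Carrier (suc k)) →
    evalList F {k} (fromCoeffs F {k} Q) x
      ≡ horner (tabulate (λ i → eval F {k} (Q i) (init x))) (last x)
  evalList-fromCoeffs {k} {zero}  Q x = ≡.refl
  evalList-fromCoeffs {k} {suc m} Q x =
    ≡.cong (λ r → eval F {k} (Q Fin.zero) (init x) + last x * r)
           (evalList-fromCoeffs (Q ∘ Fin.suc) x)

  module _ {m k} (Q : Fin (suc m) → Poly F k)
           (represents : SignRepresents F {suc k} (suc m) (fromCoeffs F {k} Q) Par)
           (a : Vector (Fin (suc m)) k) where

    coefficient : Fin (suc m) → Carrier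
    coefficient i = eval F {k} (Q i) (embed F ∘ toℕ ∘ a)

    coefficients : Vec Carrier (suc m)
    coefficients = tabulate coefficient

    values-alternate : ∀ j → j ℕ.≤ m →
      HasSign (coordinateSum a ℕ.+ j) (horner coefficients (embed F j))
    values-alternate j j≤m =
      ≡.subst (λ j → HasSign (coordinateSum a ℕ.+ j) (horner coefficients (embed F j)))
              (Fin.toℕ-fromℕ< (s≤s j≤m))
              (≡.subst (HasSign _) value≡ (SignOfParity⇒HasSign _ parity))
      where
      J = fromℕ< (s≤s j≤m)
      aJ = insertAt a (fromℕ k) J
      point : Vector Carrier (suc k)
      point l = embed F (toℕ (aJ l))
      value = evalList F {k} (fromCoeffs F {k} Q) point
      parity : SignOfParity (coordinateSum a ℕ.+ toℕ J) value
      parity = ≡.subst (λ π → (π ≡ 0 → 0# < value) × (π ≡ 1 → value < 0#))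
                       (Par-insertAt-last a J) (represents aJ)
      value≡ : value ≡ horner coefficients (embed F (toℕ J))
      value≡ = ≡.trans (evalList-fromCoeffs Q point) (≡.cong₂ horner
        (Vec.tabulate-cong λ i →
          eval-cong (Q i) (≡.cong (embed F ∘ toℕ) ∘ insertAt-last-inject₁ a J))
        (≡.cong (embed F ∘ toℕ) (insertAt-lookup a (fromℕ k) J)))

    coefficients-alternate : ∀ i → HasSign (coordinateSum a ℕ.+ toℕ i) (coefficient i)
    coefficients-alternate i = ≡.subst (HasSign _) (Vec.lookup∘tabulate coefficient i)
      (Alternating-lookup (Alternating-from-values m coefficients (coordinateSum a) values-alternate) i)

lemma3p4 : ∀ {c ℓ₁ ℓ₂} (F : OrderedField c ℓ₁ ℓ₂) (m k : ℕ) →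
    let open OrderedField F in
    (Q : Fin (suc m) → Poly F k) →
    SignRepresents F {suc k} (suc m) (fromCoeffs F {k} {suc m} Q) Par →
    ∀ (i : Fin (suc m)) →
    SignRepresents F {k} (suc m) (scale F {k} (pow F (- 1#) (toℕ i)) (Q i)) Par
lemma3p4 F m k Q represents i a =
  HasSign⇒SignOfParity F (coordinateSum a)
    (HasSign-resp F (sym (eval-scale F _ (Q i) (embed F ∘ toℕ ∘ a)))
      (HasSign-pow F (coordinateSum a) (toℕ i) (coefficients-alternate F Q represents a i)))
  where open OrderedField F using (sym)
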